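{- Let $\mathcal{G}=(L,\vee,\wedge,\odot,\rightarrow,0,1)$ be an involutive right-residuated l-groupoid whose derived implication $\Rightarrow$ satisfies $[(x\Rightarrow y)\Rightarrow y]\wedge(x\vee y)=x\vee y$ for all $x,y\in L$. Then $\mathcal{G}$ is an integral commutative residuated lattice (i.e. $\mathcal{G}$ is integral and $\odot$ is both commutative and associative) if and only if $\odot$ is associative.
   Context: A right-residuated l-groupoid is an algebra $(L,\vee,\wedge,\odot,\rightarrow,0,1)$ of type $(2,2,2,2,0,0)$ such that $(L,\vee,\wedge)$ is a lattice with least element $0$ and greatest element $1$, $1\odot x=x$ for all $x$, and $x\odot y\le z$ iff $x\le y\rightarrow z$ for all $x,y,z$. It is integral if $1\odot x=x\odot 1=x$ for all $x$, and commutative if $x\odot y=y\odot x$ for all $x,y$. Put $\rceil x:=x\rightarrow 0$; it is involutive if $x\le y$ implies $\rceil y\le\rceil x$ and $\rceil\rceil x=x$. The derived implication is $x\Rightarrow y:=\rceil y\rightarrow\rceil x$. -}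

module Defs where

open import Level using (Level; suc)
open import Relation.Binary.PropositionalEquality using (_≡_)
open import Algebra.Lattice.Structures using (IsLattice)
open import Data.Product using (_×_)

record RRLGroupoid (ℓ : Level) : Set (suc ℓ) where
  infixr 6 _∨_
  infixr 7 _∧_
  infixl 8 _⊙_
  infixr 5 _⇾_
  infix 4 _≤_
  field
    Carrier   : Set ℓ
    _∨_ _∧_ _⊙_ _⇾_ : Carrier → Carrier → Carrier
    𝟘 𝟙       : Carrier
    isLattice : IsLattice _≡_ _∨_ _∧_

  _≤_ : Carrier → Carrier → Set ℓ
  x ≤ y = x ∧ y ≡ x

  field
    𝟘-least    : ∀ x → 𝟘 ≤ x
    𝟙-greatest : ∀ x → x ≤ 𝟙
    𝟙-identityˡ : ∀ x → 𝟙 ⊙ x ≡ x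
    residuated : ∀ x y z → (x ⊙ y ≤ z → x ≤ y ⇾ z) × (x ≤ y ⇾ z → x ⊙ y ≤ z)

  ⌉_ : Carrier → Carrier
  ⌉ x = x ⇾ 𝟘

  _⇒_ : Carrier → Carrier → Carrier
  x ⇒ y = (⌉ y) ⇾ (⌉ x)

  Involutive : Set ℓ
  Involutive = (∀ x y → x ≤ y → ⌉ y ≤ ⌉ x) × (∀ x → ⌉ (⌉ x) ≡ x)

  Integral : Set ℓ
  Integral = ∀ x → (𝟙 ⊙ x ≡ x) × (x ⊙ 𝟙 ≡ x)

  Commutative : Set ℓ
  Commutative = ∀ x y → x ⊙ y ≡ y ⊙ x

  Associative : Set ℓ
  Associative = ∀ x y z → (x ⊙ y) ⊙ z ≡ x ⊙ (y ⊙ z)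

  Condition : Set ℓ
  Condition = ∀ x y → ((x ⇒ y) ⇒ y) ∧ (x ∨ y) ≡ x ∨ y

  IntegralCommutativeResiduatedLattice : Set ℓ
  IntegralCommutativeResiduatedLattice = Integral × Commutative × Associative

module Submission where

open import Defs
open import Level using (Level)
open import Data.Product using (_×_; _,_; proj₁; proj₂)
open import Function using (_∘_)
open import Relation.Binary.PropositionalEquality
open import Algebra.Lattice.Bundles using (Lattice)
open import Algebra.Lattice.Structures using (IsLattice)
import Algebra.Lattice.Properties.Lattice as LatticeProperties

-- The proof works with "orthogonality" a ⟂ b := a ⊙ b ≤ 0. Involutivity makes
-- a ≤ b equivalent to a ⟂ ⌉ b, makes ⟂ symmetric, and makes an element
-- determined by its annihilators; with associativity, ⟂ is then invariant
-- under cyclic rotation of a triple product. Integrality follows since x and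
-- x ⊙ 1 have the same annihilators. The Condition gives x ≤ (x ⇒ y) ⇒ y, which
-- rotates into modus ponens (x ⇒ y) ⊙ x ≤ y; conversely a rotation yields
-- z ≤ x ⇒ (x ⊙ z), and together z ⊙ x ≤ x ⊙ z for all x, z.

module _ {ℓ : Level} (G : RRLGroupoid ℓ) where
  open RRLGroupoid G
  open IsLattice isLattice using (∧-assoc; ∧-comm; absorptive)

  lattice : Lattice ℓ ℓ
  lattice = record { isLattice = isLattice }

  open LatticeProperties lattice using (∧-idem)

  ≤-refl : ∀ {x} → x ≤ x
  ≤-refl {x} = ∧-idem x

  ≤-trans : ∀ {x y z} → x ≤ y → y ≤ z → x ≤ z
  ≤-trans {x} {y} {z} x≤y y≤z = begin
    x ∧ z       ≡⟨ cong (_∧ z) x≤y ⟨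
    (x ∧ y) ∧ z ≡⟨ ∧-assoc x y z ⟩
    x ∧ (y ∧ z) ≡⟨ cong (x ∧_) y≤z ⟩
    x ∧ y       ≡⟨ x≤y ⟩
    x           ∎
    where open ≡-Reasoning

  ≤-antisym : ∀ {x y} → x ≤ y → y ≤ x → x ≡ y
  ≤-antisym {x} {y} x≤y y≤x = trans (sym x≤y) (trans (∧-comm x y) y≤x)

  x≤x∨y : ∀ x y → x ≤ x ∨ y
  x≤x∨y = proj₂ absorptive

  ⊙≤⇒≤⇾ : ∀ {x y z} → x ⊙ y ≤ z → x ≤ y ⇾ z
  ⊙≤⇒≤⇾ {x} {y} {z} = proj₁ (residuated x y z)

  ≤⇾⇒⊙≤ : ∀ {x y z} → x ≤ y ⇾ z → x ⊙ y ≤ z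
  ≤⇾⇒⊙≤ {x} {y} {z} = proj₂ (residuated x y z)

  ⊙-monoˡ-≤ : ∀ {x x′} y → x ≤ x′ → x ⊙ y ≤ x′ ⊙ y
  ⊙-monoˡ-≤ y x≤x′ = ≤⇾⇒⊙≤ (≤-trans x≤x′ (⊙≤⇒≤⇾ ≤-refl))

  infix 4 _⟂_

  _⟂_ : Carrier → Carrier → Set ℓ
  a ⟂ b = a ⊙ b ≤ 𝟘

  ⟂⇒≤⇒ : ∀ {x y z} → (z ⊙ ⌉ y) ⟂ x → z ≤ x ⇒ y
  ⟂⇒≤⇒ = ⊙≤⇒≤⇾ ∘ ⊙≤⇒≤⇾

  module _ (inv : Involutive) where

    ⌉-involutive : ∀ x → ⌉ (⌉ x) ≡ x
    ⌉-involutive = proj₂ inv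

    ≤⇒⟂⌉ : ∀ {a b} → a ≤ b → a ⟂ ⌉ b
    ≤⇒⟂⌉ {a} {b} a≤b = ≤⇾⇒⊙≤ (subst (a ≤_) (sym (⌉-involutive b)) a≤b)

    ⟂⌉⇒≤ : ∀ {a b} → a ⟂ ⌉ b → a ≤ b
    ⟂⌉⇒≤ {a} {b} a⟂⌉b = subst (a ≤_) (⌉-involutive b) (⊙≤⇒≤⇾ a⟂⌉b)

    ⟂-sym : ∀ {a b} → a ⟂ b → b ⟂ a
    ⟂-sym {a} {b} a⟂b =
      ≤⇾⇒⊙≤ (subst (_≤ ⌉ a) (⌉-involutive b) (proj₁ inv a (⌉ b) (⊙≤⇒≤⇾ a⟂b)))

    annihilators-⊇⇒≤ : ∀ {a b} → (∀ c → b ⟂ c → a ⟂ c) → a ≤ b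
    annihilators-⊇⇒≤ {b = b} h = ⟂⌉⇒≤ (h (⌉ b) (≤⇒⟂⌉ ≤-refl))

    module _ (assoc : Associative) where

      ⟂-rotate : ∀ {a b c} → (a ⊙ b) ⟂ c → (b ⊙ c) ⟂ a
      ⟂-rotate {a} {b} {c} ab⟂c = ⟂-sym (subst (_≤ 𝟘) (assoc a b c) ab⟂c)

      ⊙-identityʳ : ∀ x → x ⊙ 𝟙 ≡ x
      ⊙-identityʳ x = ≤-antisym
        (annihilators-⊇⇒≤ λ c → subst (_≤ 𝟘) (sym x𝟙c≡xc))
        (annihilators-⊇⇒≤ λ c → subst (_≤ 𝟘) x𝟙c≡xc)
        where
        x𝟙c≡xc : ∀ {c} → x ⊙ 𝟙 ⊙ c ≡ x ⊙ c
        x𝟙c≡xc {c} = trans (assoc x 𝟙 c) (cong (x ⊙_) (𝟙-identityˡ c))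

      integral : Integral
      integral x = 𝟙-identityˡ x , ⊙-identityʳ x

      module _ (cond : Condition) where

        ⇒-mp : ∀ x y → (x ⇒ y) ⊙ x ≤ y
        ⇒-mp x y = ⟂⌉⇒≤ (⟂-rotate (⟂-rotate (≤⇾⇒⊙≤ (≤⇾⇒⊙≤ x≤[x⇒y]⇒y))))
          where
          x≤[x⇒y]⇒y : x ≤ (x ⇒ y) ⇒ y
          x≤[x⇒y]⇒y = ≤-trans (x≤x∨y x y) (trans (∧-comm (x ∨ y) _) (cond x y))

        ⊙-comm-≤ : ∀ x z → z ⊙ x ≤ x ⊙ z
        ⊙-comm-≤ x z =
          ≤-trans (⊙-monoˡ-≤ x (⟂⇒≤⇒ (⟂-rotate (≤⇒⟂⌉ ≤-refl)))) (⇒-mp x (x ⊙ z))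

        ⊙-comm : Commutative
        ⊙-comm x y = ≤-antisym (⊙-comm-≤ y x) (⊙-comm-≤ x y)

corollary2 : ∀ {ℓ : Level} (G : RRLGroupoid ℓ) →
    RRLGroupoid.Involutive G →
    RRLGroupoid.Condition G →
    (RRLGroupoid.IntegralCommutativeResiduatedLattice G → RRLGroupoid.Associative G)
    × (RRLGroupoid.Associative G → RRLGroupoid.IntegralCommutativeResiduatedLattice G)
corollary2 G inv cond =
  proj₂ ∘ proj₂ ,
  λ assoc → integral G inv assoc , ⊙-comm G inv assoc cond , assoc
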